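{- Let $\mathcal{S}$ be the class of axiom schemata that are characteristic of $\mathbf{L_1}$ and nontrivial with respect to $(\mathrm{A_t})$, and for $x,y\in\mathcal{S}$ write $x<_{QNT}y$ iff $x$ is quasi-nontrivial with respect to $y$. Then $<_{QNT}$ is symmetric on $\mathcal{S}$.
   Context: $\mathbf{L_1}$: formulas built from atomic $\epsilon xy$ ($x,y$ name variables) by $\neg,\vee$ (other connectives defined); $\mathbf{L_1}$ is the closure under modus ponens of all instances of classical tautologies and all instances of (Ax1) $\epsilon ab\supset\epsilon aa$, (Ax2) $(\epsilon ab\wedge\epsilon bc)\supset\epsilon ac$, (Ax3) $(\epsilon ab\wedge\epsilon bc)\supset\epsilon ba$. A schema $A$ is characteristic of $\mathbf{L_1}$ if the closure under modus ponens of all tautology instances and all instances of $A$ (substituting name variables for name variables) equals $\mathbf{L_1}$. A formula is an instance of a tautology if it is a tautology when distinct atomic formulas are treated as distinct propositional atoms. $nv(A)$: the tuple of distinct name variables of $A$ in order of first occurrence; $\#nv(A)$ its length. $(\mathrm{A_t})$: $\epsilon ab\supset(\epsilon aa\wedge(\epsilon bc\supset(\epsilon ac\wedge\epsilon ba)))$. Trivial w.r.t. $(\mathrm{A_t})$: $A$ with $nv(A)=(x_1,\dots,x_n)$, $n\ge3$, is trivial if for some permutation $\rho$ and distinct fresh name variables $y_1,\dots,y_{n-3}$ (not among the $x_i$ nor $a,b,c$), the substitution $\sigma$ sending $x_{\rho(1)},x_{\rho(2)},x_{\rho(3)}$ to $a,b,c$ and $x_{\rho(3+j)}$ to $y_j$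 makes $\sigma(A)\equiv(\mathrm{A_t})$ a tautology instance; nontrivial means not trivial. Quasi-trivial: for $nv(A)=(x_1,\dots,x_n)$, $nv(B)=(y_1,\dots,y_m)$, $n,m\ge3$, $A$ is quasi-trivial w.r.t. $B$ if (when $n\le m$) for some permutation $\rho$ of $\{1,\dots,m\}$ and distinct name variables $u_1,\dots,u_{m-n}$ not among the $x_i,y_j$, the substitution $\sigma$ sending $y_{\rho(i)}$ to $x_i$ ($i\le n$) and $y_{\rho(n+j)}$ to $u_j$ makes $\sigma(B)\equiv A$ a tautology instance; or (when $n>m$) for some permutation $\rho$ of $\{1,\dots,n\}$ and distinct name variables $v_1,\dots,v_{n-m}$ not among the $x_i,y_j$, the substitution $\sigma$ sending $x_{\rho(i)}$ to $y_i$ ($i\le m$) and $x_{\rho(m+j)}$ to $v_j$ makes $\sigma(A)\equiv B$ a tautology instance. Quasi-nontrivial means not quasi-trivial. -}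

module Defs where

open import Data.Nat using (ℕ; zero; suc; _≤_; _<_; _∸_)
import Data.Nat as ℕ
open import Data.Bool using (Bool; true; false; not; _∨_)
open import Data.List using (List; []; _∷_; _++_; length; lookup; deduplicate)
open import Data.List.Membership.Propositional using (_∉_)
open import Data.Fin using (Fin; toℕ)
open import Data.Fin.Permutation using (Permutation; _⟨$⟩ʳ_)
open import Data.Product using (Σ; ∃; _×_; _,_)
open import Data.Sum using (_⊎_)
open import Relation.Binary.PropositionalEquality using (_≡_)
open import Relation.Nullary using (¬_)

Name : Set
Name = ℕ

data Fm : Set where
  eps : Name → Name → Fm
  neg : Fm → Fm
  _or_ : Fm → Fm → Fm

_⊃_ : Fm → Fm → Fm
A ⊃ B = neg A or B

_and_ : Fm → Fm → Fm
A and B = neg (neg A or neg B)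

_≡≡_ : Fm → Fm → Fm
A ≡≡ B = (A ⊃ B) and (B ⊃ A)

-- Propositional evaluation: each atomic formula ε x y is an independent atom.
eval : (Name → Name → Bool) → Fm → Bool
eval v (eps x y) = v x y
eval v (neg A) = not (eval v A)
eval v (A or B) = eval v A ∨ eval v B

Taut : Fm → Set
Taut A = ∀ v → eval v A ≡ true

sub : (Name → Name) → Fm → Fm
sub s (eps x y) = eps (s x) (s y)
sub s (neg A) = neg (sub s A)
sub s (A or B) = sub s A or sub s B

data Closure (Ax : Fm → Set) : Fm → Set where
  taut : ∀ {A} → Taut A → Closure Ax A
  ax   : ∀ {A} → Ax A → Closure Ax A
  mp   : ∀ {A B} → Closure Ax A → Closure Ax (A ⊃ B) → Closure Ax B

data L1Ax : Fm → Set where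
  ax1 : ∀ a b → L1Ax (eps a b ⊃ eps a a)
  ax2 : ∀ a b c → L1Ax ((eps a b and eps b c) ⊃ eps a c)
  ax3 : ∀ a b c → L1Ax ((eps a b and eps b c) ⊃ eps b a)

L1 : Fm → Set
L1 = Closure L1Ax

InstOf : Fm → Fm → Set
InstOf A F = ∃ λ (s : Name → Name) → F ≡ sub s A

Characteristic : Fm → Set
Characteristic A = ∀ F → (Closure (InstOf A) F → L1 F) × (L1 F → Closure (InstOf A) F)

vars : Fm → List Name
vars (eps x y) = x ∷ y ∷ []
vars (neg A) = vars A
vars (A or B) = vars A ++ vars B

nv : Fm → List Name
nv A = deduplicate ℕ._≟_ (vars A)

va vb vc : Name
va = 0
vb = 1
vc = 2

At : Fm
At = eps va vb ⊃ (eps va va and (eps vb vc ⊃ (eps va vc and eps vb va)))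

pad : List Name → (ℕ → Name) → ℕ → Name
pad [] us i = us i
pad (x ∷ xs) us zero = x
pad (x ∷ xs) us (suc i) = pad xs us i

-- RenOnto B P avoid C: with nv(B) = (y_1..y_m) and P = (p_1..p_k), there is a
-- permutation ρ of {1..m} and distinct name variables u_1..u_{m-k} not in
-- 'avoid' such that the substitution σ sending y_{ρ(i)} to p_i (i ≤ k) and
-- y_{ρ(k+j)} to u_j makes σ(B) ≡ C a tautology instance.
RenOnto : Fm → List Name → List Name → Fm → Set
RenOnto B P avoid C =
  Σ (Permutation (length (nv B)) (length (nv B))) λ ρ →
  Σ (ℕ → Name) λ us →
    (∀ j k → j < length (nv B) ∸ length P → k < length (nv B) ∸ length P →
       us j ≡ us k → j ≡ k) ×
    (∀ j → j < length (nv B) ∸ length P → us j ∉ avoid) ×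
    Σ (Name → Name) λ σ →
      (∀ (i : Fin (length (nv B))) →
         σ (lookup (nv B) (ρ ⟨$⟩ʳ i)) ≡ pad P us (toℕ i)) ×
      Taut (sub σ B ≡≡ C)

Trivial : Fm → Set
Trivial A = 3 ≤ length (nv A) ×
  RenOnto A (va ∷ vb ∷ vc ∷ []) (nv A ++ (va ∷ vb ∷ vc ∷ [])) At

Nontrivial : Fm → Set
Nontrivial A = ¬ Trivial A

QuasiTrivial : Fm → Fm → Set
QuasiTrivial A B = 3 ≤ length (nv A) × 3 ≤ length (nv B) ×
  ((length (nv A) ≤ length (nv B) × RenOnto B (nv A) (nv A ++ nv B) A)
   ⊎ (length (nv B) < length (nv A) × RenOnto A (nv B) (nv A ++ nv B) B))

QuasiNontrivial : Fm → Fm → Set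
QuasiNontrivial A B = ¬ QuasiTrivial A B

InS : Fm → Set
InS A = Characteristic A × Nontrivial A

_<QNT_ : Fm → Fm → Set
x <QNT y = QuasiNontrivial x y

-- Quasi-triviality is symmetric by the very shape of its definition, except when
-- nv(A) and nv(B) have the same length: then a renaming σ with σ(B) ≡ A
-- tautological has to be turned around. Such a σ maps nv(B) bijectively onto
-- nv(A), so it has a left inverse τ on nv(B), and τ(A) ≡ τσ(B) = B is again a
-- tautology instance.
module Submission where

open import Defs
open import Data.Nat using (zero; _<_; _∸_)
import Data.Nat as ℕ
open import Data.Nat.Properties using (≤-reflexive; <⇒≤; m≤n⇒m<n∨m≡n; n∸n≡0)
open import Data.Bool using (true; false; not; _∨_)
open import Data.List using (List; []; _∷_; _++_; length; lookup)
open import Data.List.Membership.Propositional using (_∈_)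
open import Data.List.Membership.Propositional.Properties using (∈-++⁺ˡ; ∈-++⁺ʳ; ∈-lookup; ∈-deduplicate⁺)
open import Data.List.Relation.Binary.Subset.Propositional using (_⊆_)
open import Data.List.Relation.Binary.Subset.Propositional.Properties using (⊆-reflexive-↭)
open import Data.List.Relation.Binary.Permutation.Propositional.Properties using (++-comm)
open import Data.List.Relation.Unary.Any using (here; there; index)
open import Data.List.Relation.Unary.Any.Properties using (lookup-index)
import Data.List.Relation.Unary.All as All
open import Data.List.Relation.Unary.Unique.Propositional using (Unique)
open import Data.List.Relation.Unary.AllPairs using (_∷_)
open import Data.List.Relation.Unary.Unique.DecPropositional.Properties using (deduplicate-!)
open import Data.Fin using (Fin; toℕ; cast)
import Data.Fin as Fin
open import Data.Fin.Properties using (toℕ-cast)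
open import Data.Fin.Permutation using (Permutation; _⟨$⟩ʳ_; _⟨$⟩ˡ_; flip; inverseˡ; inverseʳ; _∘ₚ_; cast-id)
open import Data.Product using (_,_)
open import Data.Sum using (inj₁; inj₂)
open import Data.Empty using (⊥; ⊥-elim)
open import Relation.Binary.Definitions using (DecidableEquality)
open import Relation.Binary.PropositionalEquality
open import Relation.Nullary using (yes; no)

iff-true⇒≡ : ∀ a b → not (not (not a ∨ b) ∨ not (not b ∨ a)) ≡ true → a ≡ b
iff-true⇒≡ false false _ = refl
iff-true⇒≡ true  true  _ = refl

iff-refl : ∀ a → not (not (not a ∨ a) ∨ not (not a ∨ a)) ≡ true
iff-refl false = refl
iff-refl true  = refl

taut-≡≡⇒eval-≡ : ∀ {A B} → Taut (A ≡≡ B) → ∀ v → eval v A ≡ eval v B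
taut-≡≡⇒eval-≡ {A} {B} t v = iff-true⇒≡ (eval v A) (eval v B) (t v)

eval-≡⇒taut-≡≡ : ∀ {A B} → (∀ v → eval v A ≡ eval v B) → Taut (A ≡≡ B)
eval-≡⇒taut-≡≡ {A} {B} e v =
  subst (λ b → not (not (not (eval v A) ∨ b) ∨ not (not b ∨ eval v A)) ≡ true)
        (e v) (iff-refl (eval v A))

eval-sub : ∀ v s A → eval v (sub s A) ≡ eval (λ a b → v (s a) (s b)) A
eval-sub v s (eps x y) = refl
eval-sub v s (neg A)   = cong not (eval-sub v s A)
eval-sub v s (A or B)  = cong₂ _∨_ (eval-sub v s A) (eval-sub v s B)

sub-∘ : ∀ f g A → sub f (sub g A) ≡ sub (λ z → f (g z)) A
sub-∘ f g (eps x y) = refl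
sub-∘ f g (neg A)   = cong neg (sub-∘ f g A)
sub-∘ f g (A or B)  = cong₂ _or_ (sub-∘ f g A) (sub-∘ f g B)

sub-id-on-vars : ∀ f A → (∀ {w} → w ∈ vars A → f w ≡ w) → sub f A ≡ A
sub-id-on-vars f (eps x y) h = cong₂ eps (h (here refl)) (h (there (here refl)))
sub-id-on-vars f (neg A)   h = cong neg (sub-id-on-vars f A h)
sub-id-on-vars f (A or B)  h =
  cong₂ _or_ (sub-id-on-vars f A (λ w∈ → h (∈-++⁺ˡ w∈)))
             (sub-id-on-vars f B (λ w∈ → h (∈-++⁺ʳ (vars A) w∈)))

taut-≡≡-sub-invert : ∀ σ τ B C → (∀ {w} → w ∈ vars B → τ (σ w) ≡ w) →
                     Taut (sub σ B ≡≡ C) → Taut (sub τ C ≡≡ B)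
taut-≡≡-sub-invert σ τ B C τσ≡id t = eval-≡⇒taut-≡≡ {sub τ C} {B} λ v → begin
  eval v (sub τ C)                        ≡⟨ eval-sub v τ C ⟩
  eval (λ a b → v (τ a) (τ b)) C          ≡˘⟨ taut-≡≡⇒eval-≡ {sub σ B} {C} t _ ⟩
  eval (λ a b → v (τ a) (τ b)) (sub σ B)  ≡˘⟨ eval-sub v τ (sub σ B) ⟩
  eval v (sub τ (sub σ B))                ≡⟨ cong (eval v) (sub-∘ τ σ B) ⟩
  eval v (sub (λ z → τ (σ z)) B)          ≡⟨ cong (eval v) (sub-id-on-vars _ B τσ≡id) ⟩
  eval v B                                ∎
  where open ≡-Reasoning

lookup-injective : ∀ {A : Set} {xs : List A} → Unique xs →
                   ∀ {i j} → lookup xs i ≡ lookup xs j → i ≡ j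
lookup-injective (_  ∷ _) {Fin.zero}  {Fin.zero}  _ = refl
lookup-injective (x∉ ∷ _) {Fin.zero}  {Fin.suc j} e = ⊥-elim (All.lookup x∉ (∈-lookup j) e)
lookup-injective (x∉ ∷ _) {Fin.suc i} {Fin.zero}  e = ⊥-elim (All.lookup x∉ (∈-lookup i) (sym e))
lookup-injective (_  ∷ u) {Fin.suc i} {Fin.suc j} e = cong Fin.suc (lookup-injective u e)

pad-lookup : ∀ (P : List Name) us {n} (eq : n ≡ length P) (i : Fin n) →
             pad P us (toℕ i) ≡ lookup P (cast eq i)
pad-lookup P us eq i = trans (cong (pad P us) (sym (toℕ-cast eq i))) (pad-lookup′ P (cast eq i))
  where
  pad-lookup′ : ∀ P (i : Fin (length P)) → pad P us (toℕ i) ≡ lookup P i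
  pad-lookup′ (x ∷ P) Fin.zero    = refl
  pad-lookup′ (x ∷ P) (Fin.suc i) = pad-lookup′ P i

module _ {A B : Set} (_≟_ : DecidableEquality B) (σ : A → B) where

  InjectiveOn : List A → Set
  InjectiveOn xs = ∀ {a b} → a ∈ xs → b ∈ xs → σ a ≡ σ b → a ≡ b

  preimageIn : List A → A → B → A
  preimageIn []       d z = d
  preimageIn (w ∷ ws) d z with σ w ≟ z
  ... | yes _ = w
  ... | no  _ = preimageIn ws d z

  preimageIn-leftInverse : ∀ xs d → InjectiveOn xs → ∀ {w} → w ∈ xs → preimageIn xs d (σ w) ≡ w
  preimageIn-leftInverse (w′ ∷ ws) d inj {w} w∈ with σ w′ ≟ σ w
  ... | yes e = inj (here refl) w∈ e
  preimageIn-leftInverse (w′ ∷ ws) d inj (here refl) | no ne = ⊥-elim (ne refl)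
  preimageIn-leftInverse (w′ ∷ ws) d inj (there w∈)  | no _  =
    preimageIn-leftInverse ws d (λ a∈ b∈ → inj (there a∈) (there b∈)) w∈

  module AlongLookup (xs : List A) (ys : List B) (ys! : Unique ys)
           (π : Permutation (length xs) (length ys))
           (σ-lookup : ∀ i → σ (lookup xs i) ≡ lookup ys (π ⟨$⟩ʳ i)) where

    injectiveOn-along-lookup : InjectiveOn xs
    injectiveOn-along-lookup a∈ b∈ e = begin
      _                       ≡⟨ lookup-index a∈ ⟩
      lookup xs (index a∈)    ≡⟨ cong (lookup xs) same-index ⟩
      lookup xs (index b∈)    ≡˘⟨ lookup-index b∈ ⟩
      _                       ∎
      where
      open ≡-Reasoning
      same-index : index a∈ ≡ index b∈
      same-index = begin
        index a∈                     ≡˘⟨ inverseˡ π ⟩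
        π ⟨$⟩ˡ (π ⟨$⟩ʳ index a∈)      ≡⟨ cong (π ⟨$⟩ˡ_) (lookup-injective ys! (begin
          lookup ys (π ⟨$⟩ʳ index a∈)   ≡˘⟨ σ-lookup (index a∈) ⟩
          σ (lookup xs (index a∈))      ≡˘⟨ cong σ (lookup-index a∈) ⟩
          σ _                           ≡⟨ e ⟩
          σ _                           ≡⟨ cong σ (lookup-index b∈) ⟩
          σ (lookup xs (index b∈))      ≡⟨ σ-lookup (index b∈) ⟩
          lookup ys (π ⟨$⟩ʳ index b∈)   ∎)) ⟩
        π ⟨$⟩ˡ (π ⟨$⟩ʳ index b∈)      ≡⟨ inverseˡ π ⟩
        index b∈                     ∎

    preimageIn-lookup : ∀ d j → preimageIn xs d (lookup ys j) ≡ lookup xs (π ⟨$⟩ˡ j)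
    preimageIn-lookup d j = begin
      τ (lookup ys j)                   ≡˘⟨ cong (λ k → τ (lookup ys k)) (inverseʳ π) ⟩
      τ (lookup ys (π ⟨$⟩ʳ (π ⟨$⟩ˡ j)))  ≡˘⟨ cong τ (σ-lookup _) ⟩
      τ (σ (lookup xs (π ⟨$⟩ˡ j)))       ≡⟨ preimageIn-leftInverse xs d injectiveOn-along-lookup (∈-lookup _) ⟩
      lookup xs (π ⟨$⟩ˡ j)              ∎
      where
      open ≡-Reasoning
      τ : B → A
      τ = preimageIn xs d

RenOnto-avoid-⊆ : ∀ {B P avoid avoid′ C} → avoid′ ⊆ avoid →
                  RenOnto B P avoid C → RenOnto B P avoid′ C
RenOnto-avoid-⊆ ⊆avoid (ρ , us , us-inj , us∉ , σ , σ-lookup , t) =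
  ρ , us , us-inj , (λ j j< u∈ → us∉ j j< (⊆avoid u∈)) , σ , σ-lookup , t

RenOnto-avoid-swap : ∀ B P L₁ L₂ C → RenOnto B P (L₁ ++ L₂) C → RenOnto B P (L₂ ++ L₁) C
RenOnto-avoid-swap B P L₁ L₂ C =
  RenOnto-avoid-⊆ {B} {P} {L₁ ++ L₂} {L₂ ++ L₁} {C} (⊆-reflexive-↭ (++-comm L₂ L₁))

-- Equal lengths leave no room for fresh variables u_j, so the avoided lists are irrelevant.
RenOnto-flip : ∀ B C {avoid} avoid′ → length (nv B) ≡ length (nv C) →
               RenOnto B (nv C) avoid C → RenOnto C (nv B) avoid′ B
RenOnto-flip B C avoid′ eq (ρ , us , _ , _ , σ , σ-lookup , t) =
  ρ′ , us , (λ j _ j< → ⊥-elim (no-fresh j j<)) , (λ j j< → ⊥-elim (no-fresh j j<)) ,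
  τ , τ-lookup′ , taut-≡≡-sub-invert σ τ B C (λ w∈ → τσ≡id (∈-deduplicate⁺ ℕ._≟_ w∈)) t
  where
  no-fresh : ∀ j → j < length (nv C) ∸ length (nv B) → ⊥
  no-fresh j j< with subst (j <_) (trans (cong (_∸ length (nv B)) (sym eq)) (n∸n≡0 (length (nv B)))) j<
  ... | ()

  π : Permutation (length (nv B)) (length (nv C))
  π = flip ρ ∘ₚ cast-id eq

  ρ′ : Permutation (length (nv C)) (length (nv C))
  ρ′ = cast-id (sym eq) ∘ₚ π

  σ-lookup′ : ∀ i → σ (lookup (nv B) i) ≡ lookup (nv C) (π ⟨$⟩ʳ i)
  σ-lookup′ i = begin
    σ (lookup (nv B) i)                     ≡˘⟨ cong (λ k → σ (lookup (nv B) k)) (inverseʳ ρ) ⟩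
    σ (lookup (nv B) (ρ ⟨$⟩ʳ (ρ ⟨$⟩ˡ i)))     ≡⟨ σ-lookup _ ⟩
    pad (nv C) us (toℕ (ρ ⟨$⟩ˡ i))            ≡⟨ pad-lookup (nv C) us eq _ ⟩
    lookup (nv C) (π ⟨$⟩ʳ i)                 ∎
    where open ≡-Reasoning

  open AlongLookup ℕ._≟_ σ (nv B) (nv C) (deduplicate-! ℕ._≟_ (vars C)) π σ-lookup′

  τ : Name → Name
  τ = preimageIn ℕ._≟_ σ (nv B) zero

  τσ≡id : ∀ {w} → w ∈ nv B → τ (σ w) ≡ w
  τσ≡id = preimageIn-leftInverse ℕ._≟_ σ (nv B) zero injectiveOn-along-lookup

  τ-lookup′ : ∀ i → τ (lookup (nv C) (ρ′ ⟨$⟩ʳ i)) ≡ pad (nv B) us (toℕ i)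
  τ-lookup′ i = begin
    τ (lookup (nv C) (ρ′ ⟨$⟩ʳ i))             ≡⟨ preimageIn-lookup zero _ ⟩
    lookup (nv B) (π ⟨$⟩ˡ (ρ′ ⟨$⟩ʳ i))         ≡⟨ cong (lookup (nv B)) (inverseˡ π) ⟩
    lookup (nv B) (cast (sym eq) i)           ≡˘⟨ pad-lookup (nv B) us (sym eq) i ⟩
    pad (nv B) us (toℕ i)                     ∎
    where open ≡-Reasoning

QuasiTrivial-sym : ∀ x y → QuasiTrivial y x → QuasiTrivial x y
QuasiTrivial-sym x y (3≤y , 3≤x , inj₂ (x<y , R)) =
  3≤x , 3≤y , inj₁ (<⇒≤ x<y , RenOnto-avoid-swap y (nv x) (nv y) (nv x) x R)
QuasiTrivial-sym x y (3≤y , 3≤x , inj₁ (y≤x , R)) with m≤n⇒m<n∨m≡n y≤x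
... | inj₁ y<x = 3≤x , 3≤y , inj₂ (y<x , RenOnto-avoid-swap x (nv y) (nv y) (nv x) y R)
... | inj₂ y≡x = 3≤x , 3≤y , inj₁ (≤-reflexive (sym y≡x) , RenOnto-flip x y _ (sym y≡x) R)

proposition4p3 : ∀ (x y : Fm) → InS x → InS y → x <QNT y → y <QNT x
proposition4p3 x y _ _ x≮y y<x = x≮y (QuasiTrivial-sym x y y<x)
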